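{- Let $k\geq 1$, let $\mathcal{F}$ be a finite $k$-uniform linear family and let $\nu=\nu(\mathcal{F})$. If there exists a vertex $x$ with $|\mathcal{F}_x|>k\nu$, then $x\in S_{\mathcal{F}}$.
   Context: A family is $k$-uniform if every member has exactly $k$ elements and linear if distinct members share at most one element. A matching is a set of pairwise disjoint members; $\nu(\mathcal{F})$ is the maximum matching size. $\mathcal{F}_x=\{A\in\mathcal{F}: x\in A\}$. $S_{\mathcal{F}}$ denotes the set of vertices of $X_{\mathcal{F}}=\bigcup_{A\in\mathcal{F}}A$ that are covered by (i.e. lie in a member of) every maximum matching of $\mathcal{F}$. -}

module Defs where

open import Data.Nat using (ℕ; _≤_)
open import Data.Fin using (Fin)
open import Data.Fin.Subset using (Subset; _∩_; ∣_∣; _∈_; Empty)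
open import Data.Fin.Subset.Properties using (_∈?_)
open import Data.List using (List; length; filter)
open import Data.List.Membership.Propositional renaming (_∈_ to _∈ₗ_)
open import Data.List.Relation.Unary.All using (All)
open import Data.List.Relation.Unary.Any using (Any)
open import Data.List.Relation.Unary.Unique.Propositional using (Unique)
open import Data.List.Relation.Unary.AllPairs using (AllPairs)
open import Data.Product using (Σ; _×_; ∃)
open import Relation.Binary.PropositionalEquality using (_≡_; _≢_)

-- Vertices are elements of Fin n; a member (edge) is a subset of Fin n.
-- A finite family is a duplicate-free list of subsets.
Family : ℕ → Set
Family n = List (Subset n)

IsFamily : ∀ {n} → Family n → Set
IsFamily F = Unique F

Uniform : ∀ {n} → ℕ → Family n → Set
Uniform k F = All (λ A → ∣ A ∣ ≡ k) F

Linear : ∀ {n} → Family n → Set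
Linear F = ∀ {A B} → A ∈ₗ F → B ∈ₗ F → A ≢ B → ∣ A ∩ B ∣ ≤ 1

Disjoint : ∀ {n} → Subset n → Subset n → Set
Disjoint A B = Empty (A ∩ B)

IsMatching : ∀ {n} → Family n → List (Subset n) → Set
IsMatching F M = (∀ {A} → A ∈ₗ M → A ∈ₗ F) × Unique M × AllPairs Disjoint M

IsMatchingNumber : ∀ {n} → Family n → ℕ → Set
IsMatchingNumber F ν =
  (Σ (List _) λ M → IsMatching F M × length M ≡ ν) ×
  (∀ M → IsMatching F M → length M ≤ ν)

IsMaximumMatching : ∀ {n} → Family n → List (Subset n) → Set
IsMaximumMatching F M = IsMatching F M × (∀ M' → IsMatching F M' → length M' ≤ length M)

Star : ∀ {n} → Fin n → Family n → Family n
Star x F = filter (x ∈?_) F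

InGround : ∀ {n} → Fin n → Family n → Set
InGround x F = Any (x ∈_) F

InS : ∀ {n} → Fin n → Family n → Set
InS x F = InGround x F × (∀ M → IsMaximumMatching F M → Any (x ∈_) M)

-- Let M be a maximum matching missing x and U the union of its members, so ∣U∣ ≤ kν.
-- Every member A ∋ x meets U, for otherwise M ∪ {A} would be a larger matching.
-- By linearity two members through x share no vertex besides x, so they meet U in
-- distinct vertices, whence ∣F_x∣ ≤ ∣U∣ ≤ kν.
module Submission where

open import Defs
open import Data.Nat using (ℕ; _≤_; _<_; _*_; _+_; suc; z≤n; s≤s)
open import Data.Nat.Properties
  using (≤-trans; ≤-reflexive; n≤1+n; +-suc; +-mono-≤; +-monoʳ-≤; *-zeroʳ; *-suc; *-monoʳ-≤; <⇒≱; 1+n≰n; ≤-<-trans; module ≤-Reasoning)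
open import Data.Fin using (Fin; _≟_)
open import Data.Fin.Subset using (Subset; _∪_; _∩_; ⋃; ∣_∣; _∈_; _∉_; _-_; ⊥; Nonempty; Empty; inside; outside)
open import Data.Fin.Subset.Properties
  using (_∈?_; nonempty?; ∉⊥; ∣⊥∣≡0; x∈p∩q⁺; x∈p∩q⁻; x∈p∪q⁺; x∈p∪q⁻; x∈p⇒∣p-x∣<∣p∣; x∈p∧x≢y⇒x∈p-y; p─q⊆p)
open import Data.Vec using ([]; _∷_)
open import Data.List using (List; []; _∷_; length)
open import Data.List.Membership.Propositional using (lose) renaming (_∈_ to _∈ₗ_)
open import Data.List.Membership.Propositional.Properties using (∈-filter⁻)
open import Data.List.Relation.Unary.All as All using (All; []; _∷_)
open import Data.List.Relation.Unary.All.Properties using (all-filter)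
open import Data.List.Relation.Unary.Any using (Any; here; there; any?)
import Data.List.Relation.Unary.Any.Properties as Anyₚ
open import Data.List.Relation.Unary.Unique.Propositional using (Unique)
import Data.List.Relation.Unary.Unique.Propositional.Properties as Uniqueₚ
open import Data.List.Relation.Unary.AllPairs using (_∷_)
open import Data.Product using (_,_; proj₁; proj₂)
open import Data.Sum using (inj₁; inj₂)
open import Relation.Nullary using (¬_; yes; no; contradiction)
open import Relation.Binary.PropositionalEquality using (_≡_; _≢_; refl; sym; subst)

private
  variable
    n : ℕ
    x y : Fin n
    p : Subset n
    A B : Subset n
    F M : Family n

∣p∪q∣≤∣p∣+∣q∣ : ∀ (p q : Subset n) → ∣ p ∪ q ∣ ≤ ∣ p ∣ + ∣ q ∣
∣p∪q∣≤∣p∣+∣q∣ []            []            = z≤n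
∣p∪q∣≤∣p∣+∣q∣ (inside  ∷ p) (inside  ∷ q) = s≤s (≤-trans (∣p∪q∣≤∣p∣+∣q∣ p q) (+-monoʳ-≤ ∣ p ∣ (n≤1+n ∣ q ∣)))
∣p∪q∣≤∣p∣+∣q∣ (inside  ∷ p) (outside ∷ q) = s≤s (∣p∪q∣≤∣p∣+∣q∣ p q)
∣p∪q∣≤∣p∣+∣q∣ (outside ∷ p) (inside  ∷ q) = ≤-trans (s≤s (∣p∪q∣≤∣p∣+∣q∣ p q)) (≤-reflexive (sym (+-suc ∣ p ∣ ∣ q ∣)))
∣p∪q∣≤∣p∣+∣q∣ (outside ∷ p) (outside ∷ q) = ∣p∪q∣≤∣p∣+∣q∣ p q

∣⋃∣≤k*length : ∀ k (M : Family n) → Uniform k M → ∣ ⋃ M ∣ ≤ k * length M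
∣⋃∣≤k*length {n} k [] [] = subst (∣ ⊥ {n} ∣ ≤_) (sym (*-zeroʳ k)) (≤-reflexive (∣⊥∣≡0 n))
∣⋃∣≤k*length k (A ∷ M) (∣A∣≡k ∷ unif) = begin
  ∣ A ∪ ⋃ M ∣           ≤⟨ ∣p∪q∣≤∣p∣+∣q∣ A (⋃ M) ⟩
  ∣ A ∣ + ∣ ⋃ M ∣       ≤⟨ +-mono-≤ (≤-reflexive ∣A∣≡k) (∣⋃∣≤k*length k M unif) ⟩
  k + k * length M      ≡⟨ sym (*-suc k (length M)) ⟩
  k * suc (length M)    ∎
  where open ≤-Reasoning

x∈⋃⁺ : B ∈ₗ M → x ∈ B → x ∈ ⋃ M
x∈⋃⁺ (here refl) x∈B = x∈p∪q⁺ (inj₁ x∈B)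
x∈⋃⁺ (there B∈M) x∈B = x∈p∪q⁺ (inj₂ (x∈⋃⁺ B∈M x∈B))

x∈⋃⁻ : ∀ (M : Family n) → x ∈ ⋃ M → Any (x ∈_) M
x∈⋃⁻ []      x∈⊥  = contradiction x∈⊥ ∉⊥
x∈⋃⁻ (A ∷ M) x∈⋃ with x∈p∪q⁻ A (⋃ M) x∈⋃
... | inj₁ x∈A = here x∈A
... | inj₂ x∈⋃M = there (x∈⋃⁻ M x∈⋃M)

x∈p∧y∈p∧x≢y⇒2≤∣p∣ : x ∈ p → y ∈ p → x ≢ y → 2 ≤ ∣ p ∣
x∈p∧y∈p∧x≢y⇒2≤∣p∣ {p = p} x∈p y∈p x≢y =
  ≤-trans (s≤s (≤-trans (s≤s z≤n) (x∈p⇒∣p-x∣<∣p∣ y∈p-x))) (x∈p⇒∣p-x∣<∣p∣ x∈p)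
  where
  y∈p-x = x∈p∧x≢y⇒x∈p-y y∈p (λ y≡x → x≢y (sym y≡x))

Linear-⊆ : Linear F → (∀ {A} → A ∈ₗ M → A ∈ₗ F) → Linear M
Linear-⊆ lin M⊆F A∈M B∈M = lin (M⊆F A∈M) (M⊆F B∈M)

Linear-∷⁻ : Linear (A ∷ F) → Linear F
Linear-∷⁻ lin A∈F B∈F = lin (there A∈F) (there B∈F)

Linear⇒common-unique : Linear F → A ∈ₗ F → B ∈ₗ F → A ≢ B →
                       x ∈ A → x ∈ B → y ∈ A → y ∈ B → x ≡ y
Linear⇒common-unique {x = x} {y = y} lin A∈F B∈F A≢B x∈A x∈B y∈A y∈B with x ≟ y
... | yes x≡y = x≡y
... | no  x≢y = contradiction (lin A∈F B∈F A≢B)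
                  (<⇒≱ (x∈p∧y∈p∧x≢y⇒2≤∣p∣ (x∈p∩q⁺ (x∈A , x∈B)) (x∈p∩q⁺ (y∈A , y∈B)) x≢y))

-- Each member is charged to a vertex of U where it meets U; linearity makes the
-- charging injective, and the charged vertex is removed from U for the tail.
∣star∣≤∣U∣ : ∀ (L : Family n) {U : Subset n} → Unique L → Linear L →
             All (x ∈_) L → All (λ A → Nonempty (A ∩ U)) L → x ∉ U → length L ≤ ∣ U ∣
∣star∣≤∣U∣ [] _ _ _ _ _ = z≤n
∣star∣≤∣U∣ {x = x} (A ∷ L) {U} (A∉L ∷ uniq) lin (x∈A ∷ x∈L) ((y , y∈A∩U) ∷ meets) x∉U =
  ≤-trans (s≤s (∣star∣≤∣U∣ L uniq (Linear-∷⁻ lin) x∈L meets-U-y x∉U-y)) (x∈p⇒∣p-x∣<∣p∣ y∈U)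
  where
  y∈A : y ∈ A
  y∈A = proj₁ (x∈p∩q⁻ A U y∈A∩U)
  y∈U : y ∈ U
  y∈U = proj₂ (x∈p∩q⁻ A U y∈A∩U)
  x∉U-y : x ∉ U - y
  x∉U-y x∈U-y = x∉U (p─q⊆p _ _ x∈U-y)
  meet-U-y : B ∈ₗ L → Nonempty (B ∩ U) → Nonempty (B ∩ (U - y))
  meet-U-y {B} B∈L (z , z∈B∩U) with x∈p∩q⁻ B U z∈B∩U | z ≟ y
  ... | z∈B , z∈U | no  z≢y  = z , x∈p∩q⁺ (z∈B , x∈p∧x≢y⇒x∈p-y z∈U z≢y)
  ... | y∈B , _   | yes refl = contradiction (subst (_∈ U) (sym x≡y) y∈U) x∉U
    where
    x≡y : x ≡ y
    x≡y = Linear⇒common-unique lin (here refl) (there B∈L) (All.lookup A∉L B∈L)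
            x∈A (All.lookup x∈L B∈L) y∈A y∈B
  meets-U-y : All (λ B → Nonempty (B ∩ (U - y))) L
  meets-U-y = All.tabulate λ B∈L → meet-U-y B∈L (All.lookup meets B∈L)

Disjoint-⋃⇒All-Disjoint : Empty (A ∩ ⋃ M) → All (Disjoint A) M
Disjoint-⋃⇒All-Disjoint {A = A} A∩⋃M≡∅ = All.tabulate λ {B} B∈M (z , z∈A∩B) →
  let z∈A , z∈B = x∈p∩q⁻ A B z∈A∩B in A∩⋃M≡∅ (z , x∈p∩q⁺ (z∈A , x∈⋃⁺ B∈M z∈B))

IsMatching-∷ : IsMatching F M → A ∈ₗ F → All (A ≢_) M → Empty (A ∩ ⋃ M) →
               IsMatching F (A ∷ M)
IsMatching-∷ {F = F} {M = M} {A = A} (M⊆F , uniq , disj) A∈F A∉M A∩⋃M≡∅ =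
  A∷M⊆F , A∉M ∷ uniq , Disjoint-⋃⇒All-Disjoint A∩⋃M≡∅ ∷ disj
  where
  A∷M⊆F : ∀ {B} → B ∈ₗ A ∷ M → B ∈ₗ F
  A∷M⊆F (here refl) = A∈F
  A∷M⊆F (there B∈M) = M⊆F B∈M

uncovered⇒meets-⋃ : IsMaximumMatching F M → ¬ Any (x ∈_) M →
                     A ∈ₗ F → x ∈ A → Nonempty (A ∩ ⋃ M)
uncovered⇒meets-⋃ {M = M} {A = A} (matching , maximum) uncovered A∈F x∈A
  with nonempty? (A ∩ ⋃ M)
... | yes A∩⋃M≢∅ = A∩⋃M≢∅
... | no  A∩⋃M≡∅ = contradiction (maximum (A ∷ M) (IsMatching-∷ matching A∈F A∉M A∩⋃M≡∅)) 1+n≰n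
  where
  A∉M : All (A ≢_) M
  A∉M = All.tabulate λ { B∈M refl → uncovered (lose B∈M x∈A) }

uncovered⇒∣Star∣≤k*∣M∣ : ∀ k → IsFamily F → Uniform k F → Linear F →
                         IsMaximumMatching F M → ¬ Any (x ∈_) M →
                         length (Star x F) ≤ k * length M
uncovered⇒∣Star∣≤k*∣M∣ {F = F} {M = M} {x = x} k uniq unif lin maxM@((M⊆F , _) , _) uncovered =
  ≤-trans (∣star∣≤∣U∣ (Star x F) (Uniqueₚ.filter⁺ (x ∈?_) uniq) (Linear-⊆ lin Star⊆F)
                      (all-filter (x ∈?_) F) meets (λ x∈⋃M → uncovered (x∈⋃⁻ M x∈⋃M)))
          (∣⋃∣≤k*length k M (All.tabulate λ B∈M → All.lookup unif (M⊆F B∈M)))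
  where
  Star⊆F : ∀ {A} → A ∈ₗ Star x F → A ∈ₗ F
  Star⊆F A∈Star = proj₁ (∈-filter⁻ (x ∈?_) A∈Star)
  meets : All (λ A → Nonempty (A ∩ ⋃ M)) (Star x F)
  meets = All.tabulate λ A∈Star →
    let A∈F , x∈A = ∈-filter⁻ (x ∈?_) A∈Star in uncovered⇒meets-⋃ maxM uncovered A∈F x∈A

All⇒Any : ∀ {a p} {X : Set a} {P : X → Set p} {L : List X} → 0 < length L → All P L → Any P L
All⇒Any {L = _ ∷ _} _ (px ∷ _) = here px

0<∣Star∣⇒InGround : 0 < length (Star x F) → InGround x F
0<∣Star∣⇒InGround {x = x} {F = F} nonempty =
  Anyₚ.filter⁻ (x ∈?_) (All⇒Any nonempty (all-filter (x ∈?_) F))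

proposition1 : (n k : ℕ) → 1 ≤ k → (F : Family n) → IsFamily F →
    Uniform k F → Linear F → (ν : ℕ) → IsMatchingNumber F ν →
    (x : Fin n) → k * ν < length (Star x F) → InS x F
proposition1 n k _ F uniq unif lin ν (_ , ν-max) x big =
  0<∣Star∣⇒InGround (≤-<-trans z≤n big) , covered
  where
  covered : ∀ M → IsMaximumMatching F M → Any (x ∈_) M
  covered M maxM with any? (x ∈?_) M
  ... | yes x∈M = x∈M
  ... | no  uncovered = contradiction
          (≤-trans (uncovered⇒∣Star∣≤k*∣M∣ k uniq unif lin maxM uncovered) (*-monoʳ-≤ k (ν-max M (proj₁ maxM))))
          (<⇒≱ big)
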